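{- A graph $G$ on $n \geq 5$ vertices is strongly $T_3$-reconstructible if and only if (a) $N(v_1) \setminus \{v_2\} \neq N(v_2) \setminus \{v_1\}$ for all distinct $v_1, v_2 \in V(G)$, and (b) every edge $uv$ of $G$ that is contained in a triangle admits distinct vertices of $G$, one endpoint of the edge playing the role of $u$ and the other the role of $v$, realizing one of the configurations $\mathcal{F}_1, \dots, \mathcal{F}_6$ below (as adjacencies in $G$ among these vertices).
   Context: Graphs are finite, simple, connected and labeled; two labeled graphs are identical iff they have the same vertex set and edge set. $N(v)$ is the set of neighbors of $v$. $T_3(G)$ is the set of 3-element subsets of $V(G)$ inducing a connected subgraph of $G$. $G$ is strongly $T_3$-reconstructible if every finite, simple, connected labeled graph $H$ with $T_3(H) = T_3(G)$ is identical to $G$. The configurations (each requires the edge $uv$; "arbitrary" means that pair may or may not be adjacent): $\mathcal{F}_1$: vertices $u,v,v_1,v_2$; edges $uv_1, vv_2$; non-edges $vv_1, v_1v_2$; $uv_2$ arbitrary. $\mathcal{F}_2$: vertices $u,v,v_1,v_2$; edges $vv_1, vv_2$; non-edges $uv_1, uv_2$; $v_1v_2$ arbitrary. $\mathcal{F}_3$: vertices $u,v,v_1,v_2,v_3$; edges $uv_2, vv_3, v_2v_3, v_1v_2$; non-edges $vv_2, uv_1, vv_1, v_1v_3$; $uv_3$ arbitrary. $\mathcal{F}_4$: vertices $u,v,v_1,v_2,v_3$; edges $vv_1, v_1v_2, v_1v_3$; non-edges $uv_1, uv_2, uv_3, vv_2, vv_3$; $v_2v_3$ arbitrary. $\mathcal{F}_5$: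 vertices $u,v,v_1,v_2,v_3$ inducing the path $v\,u\,v_3\,v_2\,v_1$ (edges $uv, uv_3, v_3v_2, v_2v_1$ and no others among them). $\mathcal{F}_6$: vertices $u,v,v_1,v_2,v_3$; edges $uv_1, vv_3, v_1v_2, v_2v_3$; non-edges $vv_1, uv_3, uv_2, vv_2$; $v_1v_3$ arbitrary. -}

module Defs where

open import Data.Nat using (ℕ)
open import Data.Fin using (Fin)
open import Data.Bool using (Bool; true; false)
open import Data.Product using (Σ; ∃; _×_; _,_)
open import Data.Sum using (_⊎_)
open import Data.Unit using (⊤)
open import Relation.Nullary using (¬_)
open import Relation.Binary.PropositionalEquality using (_≡_; _≢_)
open import Function.Bundles using (_⇔_)

record Graph (n : ℕ) : Set where
  field
    adj    : Fin n → Fin n → Bool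
    sym    : ∀ x y → adj x y ≡ adj y x
    irrefl : ∀ x → adj x x ≡ false

open Graph public

module _ {n : ℕ} (G : Graph n) where

  Edge : Fin n → Fin n → Set
  Edge x y = adj G x y ≡ true

  NonEdge : Fin n → Fin n → Set
  NonEdge x y = adj G x y ≡ false

  data WalkIn (S : Fin n → Set) : Fin n → Fin n → Set where
    here  : ∀ {x} → S x → WalkIn S x x
    step  : ∀ {x y z} → S x → Edge x y → WalkIn S y z → WalkIn S x z

  InducesConnected : (Fin n → Set) → Set
  InducesConnected S = ∀ x y → S x → S y → WalkIn S x y

  Connected : Set
  Connected = InducesConnected (λ _ → ⊤)

  InT3 : Fin n → Fin n → Fin n → Set
  InT3 a b c = a ≢ b × a ≢ c × b ≢ c ×
               InducesConnected (λ x → x ≡ a ⊎ x ≡ b ⊎ x ≡ c)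

SameT3 : {n : ℕ} → Graph n → Graph n → Set
SameT3 G H = ∀ a b c → InT3 G a b c ⇔ InT3 H a b c

Identical : {n : ℕ} → Graph n → Graph n → Set
Identical G H = ∀ x y → adj G x y ≡ adj H x y

StronglyT3Reconstructible : {n : ℕ} → Graph n → Set
StronglyT3Reconstructible {n} G =
  (H : Graph n) → Connected H → SameT3 H G → Identical H G

module _ {n : ℕ} (G : Graph n) where

  NbhMinus : Fin n → Fin n → Fin n → Set
  NbhMinus x y w = Edge G x w × w ≢ y

  CondA : Set
  CondA = ∀ v₁ v₂ → v₁ ≢ v₂ →
          ¬ (∀ w → NbhMinus v₁ v₂ w ⇔ NbhMinus v₂ v₁ w)

  Distinct4 : Fin n → Fin n → Fin n → Fin n → Set
  Distinct4 a b c d = a ≢ b × a ≢ c × a ≢ d × b ≢ c × b ≢ d × c ≢ d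

  Distinct5 : Fin n → Fin n → Fin n → Fin n → Fin n → Set
  Distinct5 a b c d e = Distinct4 a b c d × a ≢ e × b ≢ e × c ≢ e × d ≢ e

  F₁ : Fin n → Fin n → Fin n → Fin n → Set
  F₁ u v v₁ v₂ = Edge G u v × Edge G u v₁ × Edge G v v₂
               × NonEdge G v v₁ × NonEdge G v₁ v₂

  F₂ : Fin n → Fin n → Fin n → Fin n → Set
  F₂ u v v₁ v₂ = Edge G u v × Edge G v v₁ × Edge G v v₂
               × NonEdge G u v₁ × NonEdge G u v₂

  F₃ : Fin n → Fin n → Fin n → Fin n → Fin n → Set
  F₃ u v v₁ v₂ v₃ = Edge G u v × Edge G u v₂ × Edge G v v₃ × Edge G v₂ v₃ × Edge G v₁ v₂
                  × NonEdge G v v₂ × NonEdge G u v₁ × NonEdge G v v₁ × NonEdge G v₁ v₃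

  F₄ : Fin n → Fin n → Fin n → Fin n → Fin n → Set
  F₄ u v v₁ v₂ v₃ = Edge G u v × Edge G v v₁ × Edge G v₁ v₂ × Edge G v₁ v₃
                  × NonEdge G u v₁ × NonEdge G u v₂ × NonEdge G u v₃
                  × NonEdge G v v₂ × NonEdge G v v₃

  F₅ : Fin n → Fin n → Fin n → Fin n → Fin n → Set
  F₅ u v v₁ v₂ v₃ = Edge G u v × Edge G u v₃ × Edge G v₃ v₂ × Edge G v₂ v₁
                  × NonEdge G u v₁ × NonEdge G u v₂ × NonEdge G v v₁
                  × NonEdge G v v₂ × NonEdge G v v₃ × NonEdge G v₁ v₃

  F₆ : Fin n → Fin n → Fin n → Fin n → Fin n → Set
  F₆ u v v₁ v₂ v₃ = Edge G u v × Edge G u v₁ × Edge G v v₃ × Edge G v₁ v₂ × Edge G v₂ v₃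
                  × NonEdge G v v₁ × NonEdge G u v₃ × NonEdge G u v₂ × NonEdge G v v₂

  Realizes : Fin n → Fin n → Set
  Realizes u v =
      (∃ λ v₁ → ∃ λ v₂ → Distinct4 u v v₁ v₂ × (F₁ u v v₁ v₂ ⊎ F₂ u v v₁ v₂))
    ⊎ (∃ λ v₁ → ∃ λ v₂ → ∃ λ v₃ → Distinct5 u v v₁ v₂ v₃ ×
         (F₃ u v v₁ v₂ v₃ ⊎ F₄ u v v₁ v₂ v₃ ⊎ F₅ u v v₁ v₂ v₃ ⊎ F₆ u v v₁ v₂ v₃))

  InTriangle : Fin n → Fin n → Set
  InTriangle x y = Edge G x y × ∃ λ w → Edge G x w × Edge G y w

  CondB : Set
  CondB = ∀ x y → InTriangle x y → Realizes x y ⊎ Realizes y x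

{-# OPTIONS --safe #-}
module Submission where

-- Three distinct vertices induce a connected subgraph iff at least two of their three pairs are
-- edges, so T₃(H) = T₃(G) says that H and G have the same Boolean majority on every triple.
--
-- An edge of G in a triangle realizes one of F₁ … F₆, and on the four or five
-- vertices of the configuration the majorities of G force that edge in H (a truth-table check).
-- A triangle-free edge of G missing from H would make at most four vertices a whole component
-- of G or H, impossible for n ≥ 5.  An edge of H missing from G would make its ends twins,
-- against (a).
--
-- Twins v₁ v₂ let us toggle the pair v₁v₂ without changing T₃.  If an edge uv
-- realizes no configuration in either orientation, then private neighbours of u and v are so
-- constrained that either two vertices are twins or there is an induced path v u p d whose four
-- vertices look alike from outside, and swapping u and p preserves T₃.

open import Defs
open import Data.Nat using (ℕ; suc; _≤_; _<_)
open import Data.Nat.Properties using (<⇒≤)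
open import Data.Fin using (Fin; _≟_)
open import Data.Fin.Properties using (any?; pigeonhole; <⇒≢)
open import Data.Fin.Permutation using (Permutation′; _⟨$⟩ʳ_; _⟨$⟩ˡ_; inverseˡ; inverseʳ; transpose)
open import Data.Bool using (Bool; true; false; not; _∧_; _∨_; _xor_)
open import Data.Bool.Properties
  using (¬-not; not-¬; ∧-comm; ∨-comm; ∧-conicalˡ; ∧-conicalʳ; ∨-conicalˡ; ∨-conicalʳ)
  renaming (_≟_ to _≟ᵇ_)
open import Data.Vec using (Vec; []; _∷_; head)
open import Data.Vec.Properties using (≡-dec)
open import Data.List using (List; []; _∷_; length; lookup)
open import Data.List.Relation.Unary.Any using (here; there; index)
open import Data.List.Relation.Unary.Any.Properties using (lookup-index)
open import Data.List.Membership.Propositional using (_∈_; _∉_)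
import Data.List.Membership.DecPropositional as DecMembership
open import Data.Product using (∃; _×_; _,_; proj₁; proj₂)
open import Data.Sum using (_⊎_; inj₁; inj₂)
open import Data.Unit using (⊤; tt)
open import Data.Empty using (⊥; ⊥-elim)
open import Function using (_∘_)
open import Function.Bundles using (_⇔_; mk⇔; Equivalence)
open import Relation.Nullary using (¬_; Dec; yes; no; does; contradiction)
open import Relation.Nullary.Decidable using (dec-true; dec-false; ¬?; _×-dec_; _⊎-dec_; decidable-stable)
import Relation.Binary.PropositionalEquality as ≡
open ≡ using (_≡_; _≢_; refl; trans; cong; cong₂; ≢-sym)

module _ {n : ℕ} (K : Graph n) where

  adj-flip : ∀ {x y b} → adj K x y ≡ b → adj K y x ≡ b
  adj-flip {x} {y} e = trans (sym K y x) e

  Edge⇒≢ : ∀ {x y} → Edge K x y → x ≢ y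
  Edge⇒≢ {x} e refl with () ← trans (≡.sym e) (irrefl K x)

  Edge-NonEdge⇒≢ : ∀ {z x y} → Edge K z x → NonEdge K z y → x ≢ y
  Edge-NonEdge⇒≢ e₁ e₂ refl with () ← trans (≡.sym e₁) e₂

  Edge-NonEdge-⊥ : ∀ {x y} → Edge K x y → NonEdge K x y → ⊥
  Edge-NonEdge-⊥ e ne with () ← trans (≡.sym e) ne

  edge? : ∀ x y → Dec (Edge K x y)
  edge? x y = adj K x y ≟ᵇ true

  non-edge? : ∀ x y → Dec (NonEdge K x y)
  non-edge? x y = adj K x y ≟ᵇ false

  NoCommonNeighbour : Fin n → Fin n → Set
  NoCommonNeighbour x y = ∀ {z} → Edge K x z → Edge K y z → ⊥

  OtherNeighbour : Fin n → Fin n → Set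
  OtherNeighbour x y = ∃ λ a → a ≢ y × Edge K x a

  other-neighbour? : ∀ x y → Dec (OtherNeighbour x y)
  other-neighbour? x y = any? (λ a → ¬? (a ≟ y) ×-dec edge? x a)

  no-other-neighbour : ∀ {x y} → ¬ OtherNeighbour x y → ∀ {a} → a ≢ y → NonEdge K x a
  no-other-neighbour none a≢y = ¬-not (λ xa → none (_ , a≢y , xa))

  walk-app : ∀ {S x y z} → WalkIn K S x y → WalkIn K S y z → WalkIn K S x z
  walk-app (here _)     w = w
  walk-app (step s e v) w = step s e (walk-app v w)

InPair : ∀ {n} → Fin n → Fin n → Fin n → Set
InPair p q x = x ≡ p ⊎ x ≡ q

in-pair? : ∀ {n} (p q x : Fin n) → InPair p q x ⊎ (x ≢ p × x ≢ q)
in-pair? p q x with x ≟ p | x ≟ q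
... | yes x≡p | _       = inj₁ (inj₁ x≡p)
... | no _    | yes x≡q = inj₁ (inj₂ x≡q)
... | no x≢p  | no x≢q  = inj₂ (x≢p , x≢q)

no-three-in-pair : ∀ {n} {p q a b c : Fin n} → InPair p q a → InPair p q b → InPair p q c →
                   a ≢ b → a ≢ c → b ≢ c → ⊥
no-three-in-pair (inj₁ refl) (inj₁ refl) _ a≢b _ _ = a≢b refl
no-three-in-pair (inj₂ refl) (inj₂ refl) _ a≢b _ _ = a≢b refl
no-three-in-pair (inj₁ refl) _ (inj₁ refl) _ a≢c _ = a≢c refl
no-three-in-pair (inj₂ refl) _ (inj₂ refl) _ a≢c _ = a≢c refl
no-three-in-pair _ (inj₁ refl) (inj₁ refl) _ _ b≢c = b≢c refl
no-three-in-pair _ (inj₂ refl) (inj₂ refl) _ _ b≢c = b≢c refl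

module _ {n : ℕ} where

  open DecMembership (_≟_ {n}) using (_∈?_)

  Closed : Graph n → List (Fin n) → Set
  Closed K xs = ∀ {s t} → s ∈ xs → Edge K s t → t ∈ xs

  closed-walk : ∀ {K xs S s t} → Closed K xs → s ∈ xs → WalkIn K S s t → t ∈ xs
  closed-walk cl s∈ (here _)     = s∈
  closed-walk cl s∈ (step _ e w) = closed-walk cl (cl s∈ e) w

  closed-unless-escape : ∀ K {xs} → (∀ {s t} → s ∈ xs → Edge K s t → t ∉ xs → ⊥) → Closed K xs
  closed-unless-escape K {xs} escape {s} {t} s∈ st with t ∈? xs
  ... | yes t∈ = t∈
  ... | no  t∉ = ⊥-elim (escape s∈ st t∉)

  -- If xs contained every vertex, positions in xs would give an injection Fin n → Fin (length xs).
  missed-vertex : (xs : List (Fin n)) → length xs < n → ∃ λ t → t ∉ xs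
  missed-vertex xs len<n with any? (λ t → ¬? (t ∈? xs))
  ... | yes found = found
  ... | no none = contradiction (trans (at i) (trans (cong (lookup xs) same) (≡.sym (at j)))) (<⇒≢ i<j)
    where
    member : ∀ t → t ∈ xs
    member t = decidable-stable (t ∈? xs) (λ t∉ → none (t , t∉))
    at : ∀ t → t ≡ lookup xs (index (member t))
    at t = lookup-index (member t)
    collision = pigeonhole len<n (λ t → index (member t))
    i = proj₁ collision
    j = proj₁ (proj₂ collision)
    i<j = proj₁ (proj₂ (proj₂ collision))
    same = proj₂ (proj₂ (proj₂ collision))

  connected-closed-small : (K : Graph n) → Connected K → (xs : List (Fin n)) →
                           length xs < n → Closed K xs → ∀ {s} → s ∈ xs → ⊥
  connected-closed-small K conn xs len<n cl {s} s∈ with missed-vertex xs len<n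
  ... | t , t∉ = t∉ (closed-walk cl s∈ (conn s t tt tt))

-- Connected triples as majorities

maj : Bool → Bool → Bool → Bool
maj true  b c = b ∨ c
maj false b c = b ∧ c

maj-baa : ∀ a b → maj b a a ≡ a
maj-baa true  true  = refl
maj-baa false true  = refl
maj-baa true  false = refl
maj-baa false false = refl

maj-swap₂₃ : ∀ a b c → maj a b c ≡ maj a c b
maj-swap₂₃ true  b c = ∨-comm b c
maj-swap₂₃ false b c = ∧-comm b c

maj-swap₁₂ : ∀ a b c → maj a b c ≡ maj b a c
maj-swap₁₂ true  true  c = refl
maj-swap₁₂ true  false c = refl
maj-swap₁₂ false true  c = refl
maj-swap₁₂ false false c = refl

module _ {n : ℕ} (K : Graph n) where

  -- Only for distinct a b c does t₃ K a b c decide {a,b,c} ∈ T₃(K).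
  t₃ : Fin n → Fin n → Fin n → Bool
  t₃ a b c = maj (adj K a b) (adj K a c) (adj K b c)

  t₃-by : ∀ {a b c x y z} → adj K a b ≡ x → adj K a c ≡ y → adj K b c ≡ z → t₃ a b c ≡ maj x y z
  t₃-by refl refl refl = refl

  t₃-swap₁₂ : ∀ a b c → t₃ a b c ≡ t₃ b a c
  t₃-swap₁₂ a b c rewrite sym K a b = maj-swap₂₃ (adj K b a) (adj K a c) (adj K b c)

  t₃-swap₂₃ : ∀ a b c → t₃ a b c ≡ t₃ a c b
  t₃-swap₂₃ a b c rewrite sym K b c = maj-swap₁₂ (adj K a b) (adj K a c) (adj K c b)

  t₃-rotate : ∀ a b c → t₃ a b c ≡ t₃ c a b
  t₃-rotate a b c = trans (t₃-swap₂₃ a b c) (t₃-swap₁₂ a c b)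

  t₃-cong : ∀ {a a′ b b′ c c′} → a ≡ a′ → b ≡ b′ → c ≡ c′ → t₃ a b c ≡ t₃ a′ b′ c′
  t₃-cong refl refl refl = refl

  t₃-tail : ∀ {x y z} → adj K x z ≡ adj K y z → t₃ x y z ≡ adj K y z
  t₃-tail {x} {y} {z} e = trans (t₃-by refl e refl) (maj-baa (adj K y z) (adj K x y))

  t₃-cherry : ∀ {c a b} → Edge K c a → Edge K c b → t₃ c a b ≡ true
  t₃-cherry ca cb = t₃-by ca cb refl

  t₃-co-cherry : ∀ {c a b} → NonEdge K c a → NonEdge K c b → t₃ c a b ≡ false
  t₃-co-cherry ca cb = t₃-by ca cb refl

  private
    Triple : Fin n → Fin n → Fin n → Fin n → Set
    Triple a b c x = x ≡ a ⊎ x ≡ b ⊎ x ≡ c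

  walk-source : ∀ {S x y} → WalkIn K S x y → S x
  walk-source (here sx)     = sx
  walk-source (step sx _ _) = sx

  isolated-no-walk : ∀ {S x y} → x ≢ y → (∀ z → S z → NonEdge K x z) → ¬ WalkIn K S x y
  isolated-no-walk x≢x _   (here _)     = x≢x refl
  isolated-no-walk _   iso (step _ e w) = Edge-NonEdge-⊥ K e (iso _ (walk-source w))

  star-connected : ∀ {S} m → S m → (∀ z → S z → z ≡ m ⊎ Edge K m z) → InducesConnected K S
  star-connected {S} m sm spoke x y sx sy = walk-app K (to-centre sx) (from-centre sy)
    where
    to-centre : ∀ {x} → S x → WalkIn K S x m
    to-centre {x} sx with spoke x sx
    ... | inj₁ refl = here sm
    ... | inj₂ e    = step sx (adj-flip K e) (here sm)
    from-centre : ∀ {y} → S y → WalkIn K S m y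
    from-centre {y} sy with spoke y sy
    ... | inj₁ refl = here sm
    ... | inj₂ e    = step sm e (here sy)

  InT3⇒t₃ : ∀ {a b c} → InT3 K a b c → t₃ a b c ≡ true
  InT3⇒t₃ {a} {b} {c} (a≢b , a≢c , b≢c , conn)
    with adj K a b in ab | adj K a c in ac | adj K b c in bc
  ... | true  | true  | _     = refl
  ... | true  | false | true  = refl
  ... | false | true  | true  = refl
  ... | false | false | _     =
    ⊥-elim (isolated-no-walk a≢b a-isolated (conn a b (inj₁ refl) (inj₂ (inj₁ refl))))
    where
    a-isolated : ∀ z → Triple a b c z → NonEdge K a z
    a-isolated _ (inj₁ refl)        = irrefl K a
    a-isolated _ (inj₂ (inj₁ refl)) = ab
    a-isolated _ (inj₂ (inj₂ refl)) = ac
  ... | false | true  | false =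
    ⊥-elim (isolated-no-walk (≢-sym a≢b) b-isolated (conn b a (inj₂ (inj₁ refl)) (inj₁ refl)))
    where
    b-isolated : ∀ z → Triple a b c z → NonEdge K b z
    b-isolated _ (inj₁ refl)        = adj-flip K ab
    b-isolated _ (inj₂ (inj₁ refl)) = irrefl K b
    b-isolated _ (inj₂ (inj₂ refl)) = bc
  ... | true  | false | false =
    ⊥-elim (isolated-no-walk (≢-sym a≢c) c-isolated (conn c a (inj₂ (inj₂ refl)) (inj₁ refl)))
    where
    c-isolated : ∀ z → Triple a b c z → NonEdge K c z
    c-isolated _ (inj₁ refl)        = adj-flip K ac
    c-isolated _ (inj₂ (inj₁ refl)) = adj-flip K bc
    c-isolated _ (inj₂ (inj₂ refl)) = irrefl K c

  t₃⇒InT3 : ∀ {a b c} → a ≢ b → a ≢ c → b ≢ c → t₃ a b c ≡ true → InT3 K a b c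
  t₃⇒InT3 {a} {b} {c} a≢b a≢c b≢c t
    with adj K a b in ab | adj K a c in ac | adj K b c in bc
  ... | true  | true  | _     = a≢b , a≢c , b≢c , star-connected a (inj₁ refl) spoke
    where
    spoke : ∀ z → Triple a b c z → z ≡ a ⊎ Edge K a z
    spoke _ (inj₁ refl)        = inj₁ refl
    spoke _ (inj₂ (inj₁ refl)) = inj₂ ab
    spoke _ (inj₂ (inj₂ refl)) = inj₂ ac
  ... | true  | false | true  = a≢b , a≢c , b≢c , star-connected b (inj₂ (inj₁ refl)) spoke
    where
    spoke : ∀ z → Triple a b c z → z ≡ b ⊎ Edge K b z
    spoke _ (inj₁ refl)        = inj₂ (adj-flip K ab)
    spoke _ (inj₂ (inj₁ refl)) = inj₁ refl
    spoke _ (inj₂ (inj₂ refl)) = inj₂ bc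
  ... | false | true  | true  = a≢b , a≢c , b≢c , star-connected c (inj₂ (inj₂ refl)) spoke
    where
    spoke : ∀ z → Triple a b c z → z ≡ c ⊎ Edge K c z
    spoke _ (inj₁ refl)        = inj₂ (adj-flip K ac)
    spoke _ (inj₂ (inj₁ refl)) = inj₂ (adj-flip K bc)
    spoke _ (inj₂ (inj₂ refl)) = inj₁ refl
  ... | false | false | _     with () ← t
  ... | true  | false | false with () ← t
  ... | false | true  | false with () ← t

module _ {n : ℕ} (L K : Graph n) where

  t₃-agree : ∀ {a b c} → adj L a b ≡ adj K a b → adj L a c ≡ adj K a c → adj L b c ≡ adj K b c →
             t₃ L a b c ≡ t₃ K a b c
  t₃-agree = t₃-by L

  t₃-agree-but₁₂ : ∀ {a b c} → adj L a c ≡ adj K a c → adj L b c ≡ adj K b c → adj K a c ≡ adj K b c →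
                   t₃ L a b c ≡ t₃ K a b c
  t₃-agree-but₁₂ {a} {b} {c} ac bc twin = begin
    t₃ L a b c                              ≡⟨ t₃-by L refl ac (trans bc (≡.sym twin)) ⟩
    maj (adj L a b) (adj K a c) (adj K a c) ≡⟨ maj-baa (adj K a c) (adj L a b) ⟩
    adj K a c                               ≡⟨ maj-baa (adj K a c) (adj K a b) ⟨
    maj (adj K a b) (adj K a c) (adj K a c) ≡⟨ t₃-by K refl refl (≡.sym twin) ⟨
    t₃ K a b c                              ∎
    where open ≡.≡-Reasoning

  t₃-agree-but₁₃ : ∀ {a b c} → adj L a b ≡ adj K a b → adj L c b ≡ adj K c b → adj K a b ≡ adj K c b →
                   t₃ L a b c ≡ t₃ K a b c
  t₃-agree-but₁₃ {a} {b} {c} ab cb twin =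
    trans (t₃-swap₂₃ L a b c) (trans (t₃-agree-but₁₂ ab cb twin) (≡.sym (t₃-swap₂₃ K a b c)))

  t₃-agree-but₂₃ : ∀ {a b c} → adj L b a ≡ adj K b a → adj L c a ≡ adj K c a → adj K b a ≡ adj K c a →
                   t₃ L a b c ≡ t₃ K a b c
  t₃-agree-but₂₃ {a} {b} {c} ba ca twin =
    trans (trans (t₃-swap₁₂ L a b c) (t₃-swap₂₃ L b a c))
      (trans (t₃-agree-but₁₂ ba ca twin) (≡.sym (trans (t₃-swap₁₂ K a b c) (t₃-swap₂₃ K b a c))))

module _ {n : ℕ} (H G : Graph n) where

  record SameT₃ : Set where
    constructor same-t₃
    field
      t₃-≡ : ∀ a b c → a ≢ b → a ≢ c → b ≢ c → t₃ H a b c ≡ t₃ G a b c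

  SameT3⇒SameT₃ : SameT3 H G → SameT₃
  SameT3⇒SameT₃ same = same-t₃ t₃-≡
    where
    t₃-≡ : ∀ a b c → a ≢ b → a ≢ c → b ≢ c → t₃ H a b c ≡ t₃ G a b c
    t₃-≡ a b c a≢b a≢c b≢c with t₃ G a b c in g | t₃ H a b c in h
    ... | true  | true  = refl
    ... | false | false = refl
    ... | true  | false
      with () ← trans (≡.sym (InT3⇒t₃ H (Equivalence.from (same a b c) (t₃⇒InT3 G a≢b a≢c b≢c g)))) h
    ... | false | true
      with () ← trans (≡.sym (InT3⇒t₃ G (Equivalence.to (same a b c) (t₃⇒InT3 H a≢b a≢c b≢c h)))) g

  SameT₃⇒SameT3 : SameT₃ → SameT3 H G
  SameT₃⇒SameT3 (same-t₃ same) a b c = mk⇔ to from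
    where
    to : InT3 H a b c → InT3 G a b c
    to t@(a≢b , a≢c , b≢c , _) = t₃⇒InT3 G a≢b a≢c b≢c (trans (≡.sym (same a b c a≢b a≢c b≢c)) (InT3⇒t₃ H t))
    from : InT3 G a b c → InT3 H a b c
    from t@(a≢b , a≢c , b≢c , _) = t₃⇒InT3 H a≢b a≢c b≢c (trans (same a b c a≢b a≢c b≢c) (InT3⇒t₃ G t))

-- The configurations force their edge

pairs₄ : ∀ {n} → Graph n → (x₀ x₁ x₂ x₃ : Fin n) → Vec Bool 6
pairs₄ K x₀ x₁ x₂ x₃ =
  adj K x₀ x₁ ∷ adj K x₀ x₂ ∷ adj K x₀ x₃ ∷ adj K x₁ x₂ ∷ adj K x₁ x₃ ∷ adj K x₂ x₃ ∷ []

pairs₅ : ∀ {n} → Graph n → (x₀ x₁ x₂ x₃ x₄ : Fin n) → Vec Bool 10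
pairs₅ K x₀ x₁ x₂ x₃ x₄ =
  adj K x₀ x₁ ∷ adj K x₀ x₂ ∷ adj K x₀ x₃ ∷ adj K x₀ x₄ ∷ adj K x₁ x₂ ∷
  adj K x₁ x₃ ∷ adj K x₁ x₄ ∷ adj K x₂ x₃ ∷ adj K x₂ x₄ ∷ adj K x₃ x₄ ∷ []

triples₄ : Vec Bool 6 → Vec Bool 4
triples₄ (p₀₁ ∷ p₀₂ ∷ p₀₃ ∷ p₁₂ ∷ p₁₃ ∷ p₂₃ ∷ []) =
  maj p₀₁ p₀₂ p₁₂ ∷ maj p₀₁ p₀₃ p₁₃ ∷ maj p₀₂ p₀₃ p₂₃ ∷ maj p₁₂ p₁₃ p₂₃ ∷ []

triples₅ : Vec Bool 10 → Vec Bool 10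
triples₅ (p₀₁ ∷ p₀₂ ∷ p₀₃ ∷ p₀₄ ∷ p₁₂ ∷ p₁₃ ∷ p₁₄ ∷ p₂₃ ∷ p₂₄ ∷ p₃₄ ∷ []) =
  maj p₀₁ p₀₂ p₁₂ ∷ maj p₀₁ p₀₃ p₁₃ ∷ maj p₀₁ p₀₄ p₁₄ ∷ maj p₀₂ p₀₃ p₂₃ ∷ maj p₀₂ p₀₄ p₂₄ ∷
  maj p₀₃ p₀₄ p₃₄ ∷ maj p₁₂ p₁₃ p₂₃ ∷ maj p₁₂ p₁₄ p₂₄ ∷ maj p₁₃ p₁₄ p₃₄ ∷ maj p₂₃ p₂₄ p₃₄ ∷ []

FirstPairForced : ∀ {k m} → (Vec Bool (suc k) → Vec Bool m) → (Bool → Vec Bool (suc k)) → Set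
FirstPairForced triples F = ∀ b h → triples h ≡ triples (F b) → head h ≡ true

all-vectors : (k : ℕ) → (Vec Bool k → Bool) → Bool
all-vectors 0       f = f []
all-vectors (suc k) f = all-vectors k (λ v → f (true ∷ v)) ∧ all-vectors k (λ v → f (false ∷ v))

all-vectors-sound : ∀ k f → all-vectors k f ≡ true → ∀ v → f v ≡ true
all-vectors-sound 0       f ok []          = ok
all-vectors-sound (suc k) f ok (true ∷ v)  = all-vectors-sound k _ (∧-conicalˡ _ _ ok) v
all-vectors-sound (suc k) f ok (false ∷ v) = all-vectors-sound k _ (∧-conicalʳ _ _ ok) v

first-pair-forced-at : ∀ {k m} → (Vec Bool (suc k) → Vec Bool m) → (Bool → Vec Bool (suc k)) →
                       Vec Bool (suc (suc k)) → Bool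
first-pair-forced-at triples F (b ∷ h) = not (does (≡-dec _≟ᵇ_ (triples h) (triples (F b)))) ∨ head h

first-pair-forced?-sound : ∀ {k m} triples (F : Bool → Vec Bool (suc k)) →
                           all-vectors (suc (suc k)) (first-pair-forced-at {k} {m} triples F) ≡ true →
                           FirstPairForced triples F
first-pair-forced?-sound {k} triples F ok b h same
  with all-vectors-sound (suc (suc k)) (first-pair-forced-at triples F) ok (b ∷ h)
... | implication rewrite dec-true (≡-dec _≟ᵇ_ (triples h) (triples (F b))) same = implication

-- The adjacency patterns of the configurations, on the tuples (u, v, v₁, v₂) and
-- (u, v, v₁, v₂, v₃), as functions of the pair left arbitrary.
F₁-pairs : Bool → Vec Bool 6
F₁-pairs uv₂ = true ∷ true ∷ uv₂ ∷ false ∷ true ∷ false ∷ []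

F₂-pairs : Bool → Vec Bool 6
F₂-pairs v₁v₂ = true ∷ false ∷ false ∷ true ∷ true ∷ v₁v₂ ∷ []

F₃-pairs : Bool → Vec Bool 10
F₃-pairs uv₃ = true ∷ false ∷ true ∷ uv₃ ∷ false ∷ false ∷ true ∷ true ∷ false ∷ true ∷ []

F₄-pairs : Bool → Vec Bool 10
F₄-pairs v₂v₃ = true ∷ false ∷ false ∷ false ∷ true ∷ false ∷ false ∷ true ∷ true ∷ v₂v₃ ∷ []

F₅-pairs : Bool → Vec Bool 10
F₅-pairs _ = true ∷ false ∷ false ∷ true ∷ false ∷ false ∷ false ∷ true ∷ false ∷ true ∷ []

F₆-pairs : Bool → Vec Bool 10
F₆-pairs v₁v₃ = true ∷ true ∷ false ∷ false ∷ false ∷ false ∷ true ∷ true ∷ v₁v₃ ∷ true ∷ []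

F₁-forced : FirstPairForced triples₄ F₁-pairs
F₁-forced = first-pair-forced?-sound triples₄ F₁-pairs refl

F₂-forced : FirstPairForced triples₄ F₂-pairs
F₂-forced = first-pair-forced?-sound triples₄ F₂-pairs refl

F₃-forced : FirstPairForced triples₅ F₃-pairs
F₃-forced = first-pair-forced?-sound triples₅ F₃-pairs refl

F₄-forced : FirstPairForced triples₅ F₄-pairs
F₄-forced = first-pair-forced?-sound triples₅ F₄-pairs refl

F₅-forced : FirstPairForced triples₅ F₅-pairs
F₅-forced = first-pair-forced?-sound triples₅ F₅-pairs refl

F₆-forced : FirstPairForced triples₅ F₆-pairs
F₆-forced = first-pair-forced?-sound triples₅ F₆-pairs refl

infixr 5 _∷≡_
_∷≡_ : ∀ {k} {x y : Bool} {xs ys : Vec Bool k} → x ≡ y → xs ≡ ys → x ∷ xs ≡ y ∷ ys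
_∷≡_ = cong₂ _∷_

module _ {n : ℕ} {H G : Graph n} (same : SameT₃ H G) where

  open SameT₃ same

  same-triples₄ : ∀ {x₀ x₁ x₂ x₃} → Distinct4 G x₀ x₁ x₂ x₃ →
                  triples₄ (pairs₄ H x₀ x₁ x₂ x₃) ≡ triples₄ (pairs₄ G x₀ x₁ x₂ x₃)
  same-triples₄ (d₀₁ , d₀₂ , d₀₃ , d₁₂ , d₁₃ , d₂₃) =
    t₃-≡ _ _ _ d₀₁ d₀₂ d₁₂ ∷≡ t₃-≡ _ _ _ d₀₁ d₀₃ d₁₃ ∷≡ t₃-≡ _ _ _ d₀₂ d₀₃ d₂₃ ∷≡
    t₃-≡ _ _ _ d₁₂ d₁₃ d₂₃ ∷≡ refl

  same-triples₅ : ∀ {x₀ x₁ x₂ x₃ x₄} → Distinct5 G x₀ x₁ x₂ x₃ x₄ →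
                  triples₅ (pairs₅ H x₀ x₁ x₂ x₃ x₄) ≡ triples₅ (pairs₅ G x₀ x₁ x₂ x₃ x₄)
  same-triples₅ ((d₀₁ , d₀₂ , d₀₃ , d₁₂ , d₁₃ , d₂₃) , d₀₄ , d₁₄ , d₂₄ , d₃₄) =
    t₃-≡ _ _ _ d₀₁ d₀₂ d₁₂ ∷≡ t₃-≡ _ _ _ d₀₁ d₀₃ d₁₃ ∷≡ t₃-≡ _ _ _ d₀₁ d₀₄ d₁₄ ∷≡
    t₃-≡ _ _ _ d₀₂ d₀₃ d₂₃ ∷≡ t₃-≡ _ _ _ d₀₂ d₀₄ d₂₄ ∷≡ t₃-≡ _ _ _ d₀₃ d₀₄ d₃₄ ∷≡
    t₃-≡ _ _ _ d₁₂ d₁₃ d₂₃ ∷≡ t₃-≡ _ _ _ d₁₂ d₁₄ d₂₄ ∷≡ t₃-≡ _ _ _ d₁₃ d₁₄ d₃₄ ∷≡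
    t₃-≡ _ _ _ d₂₃ d₂₄ d₃₄ ∷≡ refl

  forced₄ : ∀ {x₀ x₁ x₂ x₃ b} F → FirstPairForced triples₄ F → Distinct4 G x₀ x₁ x₂ x₃ →
            pairs₄ G x₀ x₁ x₂ x₃ ≡ F b → Edge H x₀ x₁
  forced₄ F forced d eq = forced _ _ (trans (same-triples₄ d) (cong triples₄ eq))

  forced₅ : ∀ {x₀ x₁ x₂ x₃ x₄ b} F → FirstPairForced triples₅ F → Distinct5 G x₀ x₁ x₂ x₃ x₄ →
            pairs₅ G x₀ x₁ x₂ x₃ x₄ ≡ F b → Edge H x₀ x₁
  forced₅ F forced d eq = forced _ _ (trans (same-triples₅ d) (cong triples₅ eq))

  -- In each chain of pair adjacencies, refl stands for the pair the configuration leaves arbitrary.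
  realizes⇒Edge : ∀ {u v} → Realizes G u v → Edge H u v
  realizes⇒Edge (inj₁ (_ , _ , d , inj₁ (uv , uv₁ , vv₂ , vv₁ , v₁v₂))) =
    forced₄ F₁-pairs F₁-forced d (uv ∷≡ uv₁ ∷≡ refl ∷≡ vv₁ ∷≡ vv₂ ∷≡ v₁v₂ ∷≡ refl)
  realizes⇒Edge (inj₁ (_ , _ , d , inj₂ (uv , vv₁ , vv₂ , uv₁ , uv₂))) =
    forced₄ F₂-pairs F₂-forced d (uv ∷≡ uv₁ ∷≡ uv₂ ∷≡ vv₁ ∷≡ vv₂ ∷≡ refl ∷≡ refl)
  realizes⇒Edge (inj₂ (_ , _ , _ , d , inj₁ (uv , uv₂ , vv₃ , v₂v₃ , v₁v₂ , vv₂ , uv₁ , vv₁ , v₁v₃))) =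
    forced₅ F₃-pairs F₃-forced d
      (uv ∷≡ uv₁ ∷≡ uv₂ ∷≡ refl ∷≡ vv₁ ∷≡ vv₂ ∷≡ vv₃ ∷≡ v₁v₂ ∷≡ v₁v₃ ∷≡ v₂v₃ ∷≡ refl)
  realizes⇒Edge
    (inj₂ (_ , _ , _ , d , inj₂ (inj₁ (uv , vv₁ , v₁v₂ , v₁v₃ , uv₁ , uv₂ , uv₃ , vv₂ , vv₃)))) =
    forced₅ F₄-pairs F₄-forced d
      (uv ∷≡ uv₁ ∷≡ uv₂ ∷≡ uv₃ ∷≡ vv₁ ∷≡ vv₂ ∷≡ vv₃ ∷≡ v₁v₂ ∷≡ v₁v₃ ∷≡ refl ∷≡ refl)
  realizes⇒Edge
    (inj₂ (_ , _ , _ , d , inj₂ (inj₂ (inj₁ (uv , uv₃ , v₃v₂ , v₂v₁ , uv₁ , uv₂ , vv₁ , vv₂ , vv₃ , v₁v₃))))) =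
    forced₅ {b = true} F₅-pairs F₅-forced d
      (uv ∷≡ uv₁ ∷≡ uv₂ ∷≡ uv₃ ∷≡ vv₁ ∷≡ vv₂ ∷≡ vv₃ ∷≡ adj-flip G v₂v₁ ∷≡ v₁v₃ ∷≡ adj-flip G v₃v₂ ∷≡ refl)
  realizes⇒Edge
    (inj₂ (_ , _ , _ , d , inj₂ (inj₂ (inj₂ (uv , uv₁ , vv₃ , v₁v₂ , v₂v₃ , vv₁ , uv₃ , uv₂ , vv₂))))) =
    forced₅ F₆-pairs F₆-forced d
      (uv ∷≡ uv₁ ∷≡ uv₂ ∷≡ uv₃ ∷≡ vv₁ ∷≡ vv₂ ∷≡ vv₃ ∷≡ v₁v₂ ∷≡ refl ∷≡ v₂v₃ ∷≡ refl)

-- Triangle-free edges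

module _ {n : ℕ} {H G : Graph n} (same : SameT₃ H G) where

  open SameT₃ same

  t₃-gained : ∀ {a b c} → a ≢ b → a ≢ c → b ≢ c → t₃ H a b c ≡ true → t₃ G a b c ≡ false → ⊥
  t₃-gained a≢b a≢c b≢c h g with () ← trans (≡.sym h) (trans (t₃-≡ _ _ _ a≢b a≢c b≢c) g)

  t₃-lost : ∀ {a b c} → a ≢ b → a ≢ c → b ≢ c → t₃ H a b c ≡ false → t₃ G a b c ≡ true → ⊥
  t₃-lost a≢b a≢c b≢c h g with () ← trans (≡.sym g) (trans (≡.sym (t₃-≡ _ _ _ a≢b a≢c b≢c)) h)

  record Lost (x y : Fin n) : Set where
    field
      in-G      : Edge G x y
      not-in-H  : NonEdge H x y
      no-common : NoCommonNeighbour G x y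

  lost-flip : ∀ {x y} → Lost x y → Lost y x
  lost-flip L = record
    { in-G = adj-flip G in-G ; not-in-H = adj-flip H not-in-H ; no-common = λ yz xz → no-common xz yz }
    where open Lost L

  module _ {x y} (L : Lost x y) where
    open Lost L

    lost-unshared : ∀ {a} → Edge G x a → NonEdge G y a
    lost-unshared xa = ¬-not (no-common xa)

    lost-spread : ∀ {a} → a ≢ y → Edge G x a → Edge H x a × Edge H y a
    lost-spread {a} a≢y xa = ∧-conicalˡ _ _ joined , ∧-conicalʳ _ _ joined
      where
      joined : adj H x a ∧ adj H y a ≡ true
      joined = trans (≡.sym (t₃-by H not-in-H refl refl))
                 (trans (t₃-≡ x y a (Edge⇒≢ G in-G) (Edge⇒≢ G xa) (≢-sym a≢y)) (t₃-by G in-G xa refl))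

    lost-unique-neighbour : ∀ {a₁ a₂} → a₁ ≢ a₂ → a₁ ≢ y → a₂ ≢ y → Edge G x a₁ → Edge G x a₂ → ⊥
    lost-unique-neighbour a₁≢a₂ a₁≢y a₂≢y xa₁ xa₂ =
      t₃-gained (≢-sym a₁≢y) (≢-sym a₂≢y) a₁≢a₂
        (t₃-cherry H (proj₂ (lost-spread a₁≢y xa₁)) (proj₂ (lost-spread a₂≢y xa₂)))
        (t₃-co-cherry G (lost-unshared xa₁) (lost-unshared xa₂))

  module _ (5≤n : 5 ≤ n) (connG : Connected G) (connH : Connected H) where

    private
      3<n : 3 < n
      3<n = <⇒≤ 5≤n
      2<n : 2 < n
      2<n = <⇒≤ 3<n

    -- The four vertices x, y, a, b would form a component of H.
    lost-both-extended : ∀ {x y a b} → Lost x y → a ≢ y → Edge G x a → b ≢ x → Edge G y b → ⊥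
    lost-both-extended {x} {y} {a} {b} L a≢y xa b≢x yb =
      connected-closed-small H connH (x ∷ y ∷ a ∷ b ∷ []) 5≤n (closed-unless-escape H escape) (here refl)
      where
      L′ = lost-flip L
      Hxb = proj₂ (lost-spread L′ b≢x yb)
      Hya = proj₂ (lost-spread L a≢y xa)
      Gxb = lost-unshared L′ yb
      Gya = lost-unshared L xa
      escape : ∀ {s t} → s ∈ x ∷ y ∷ a ∷ b ∷ [] → Edge H s t → t ∉ x ∷ y ∷ a ∷ b ∷ [] → ⊥
      escape {s} {t} s∈ st t∉ = from s∈ st
        where
        t≢x : t ≢ x
        t≢x = t∉ ∘ here
        t≢y : t ≢ y
        t≢y = t∉ ∘ there ∘ here
        t≢a : t ≢ a
        t≢a = t∉ ∘ there ∘ there ∘ here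
        t≢b : t ≢ b
        t≢b = t∉ ∘ there ∘ there ∘ there ∘ here
        Gxt : NonEdge G x t
        Gxt = ¬-not (lost-unique-neighbour L (≢-sym t≢a) a≢y t≢y xa)
        Gyt : NonEdge G y t
        Gyt = ¬-not (lost-unique-neighbour L′ (≢-sym t≢b) b≢x t≢x yb)
        from : s ∈ x ∷ y ∷ a ∷ b ∷ [] → Edge H s t → ⊥
        from (here refl) xt =
          t₃-gained (≢-sym b≢x) (≢-sym t≢x) (≢-sym t≢b) (t₃-cherry H Hxb xt) (t₃-co-cherry G Gxb Gxt)
        from (there (here refl)) yt =
          t₃-gained (≢-sym a≢y) (≢-sym t≢y) (≢-sym t≢a) (t₃-cherry H Hya yt) (t₃-co-cherry G Gya Gyt)
        from (there (there (here refl))) at =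
          t₃-gained (≢-sym a≢y) (≢-sym t≢y) (≢-sym t≢a)
            (trans (t₃-swap₁₂ H y a t) (t₃-cherry H (adj-flip H Hya) at)) (t₃-co-cherry G Gya Gyt)
        from (there (there (there (here refl)))) bt =
          t₃-gained (≢-sym b≢x) (≢-sym t≢x) (≢-sym t≢b)
            (trans (t₃-swap₁₂ H x b t) (t₃-cherry H (adj-flip H Hxb) bt)) (t₃-co-cherry G Gxb Gxt)

    -- y is a leaf and x has a second neighbour a.  Then a has at most one neighbour t besides x,
    -- the edge at is again lost and triangle-free, and t must be a leaf, so x, y, a (and t)
    -- form a component of G.
    module Pendant {x y a} (L : Lost x y) (a≢y : a ≢ y) (xa : Edge G x a)
                   (y-leaf : ¬ OtherNeighbour G y x) where

      Gya : NonEdge G y a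
      Gya = lost-unshared L xa

      x-neighbours : ∀ {r} → r ≢ y → r ≢ a → ¬ Edge G x r
      x-neighbours r≢y r≢a = lost-unique-neighbour L (≢-sym r≢a) a≢y r≢y xa

      H-away : ∀ {r} → r ≢ x → r ≢ y → r ≢ a → NonEdge H y r × NonEdge H a r
      H-away {r} r≢x r≢y r≢a = ∨-conicalˡ _ _ disjoined , ∨-conicalʳ _ _ disjoined
        where
        disjoined : adj H y r ∨ adj H a r ≡ false
        disjoined = trans (≡.sym (t₃-by H (proj₂ (lost-spread L a≢y xa)) refl refl))
                      (trans (t₃-≡ y a r (≢-sym a≢y) (≢-sym r≢y) (≢-sym r≢a))
                        (t₃-co-cherry G Gya (no-other-neighbour G y-leaf r≢x)))

      a-neighbour-≢y : ∀ {r} → Edge G a r → r ≢ y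
      a-neighbour-≢y ar = Edge-NonEdge⇒≢ G ar (adj-flip G Gya)

      a-neighbours : ∀ {r₁ r₂} → r₁ ≢ r₂ → r₁ ≢ x → r₂ ≢ x → Edge G a r₁ → Edge G a r₂ → ⊥
      a-neighbours r₁≢r₂ r₁≢x r₂≢x ar₁ ar₂ =
        t₃-lost (Edge⇒≢ G ar₁) (Edge⇒≢ G ar₂) r₁≢r₂
          (t₃-co-cherry H (proj₂ (away ar₁ r₁≢x)) (proj₂ (away ar₂ r₂≢x)))
          (t₃-cherry G ar₁ ar₂)
        where
        away : ∀ {r} → Edge G a r → r ≢ x → NonEdge H y r × NonEdge H a r
        away ar r≢x = H-away r≢x (a-neighbour-≢y ar) (≢-sym (Edge⇒≢ G ar))

      lost-next : ∀ {t} → t ≢ x → Edge G a t → Lost a t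
      lost-next {t} t≢x at = record
        { in-G = at ; not-in-H = proj₂ (H-away t≢x t≢y t≢a) ; no-common = no-common }
        where
        t≢y = a-neighbour-≢y at
        t≢a = ≢-sym (Edge⇒≢ G at)
        no-common : NoCommonNeighbour G a t
        no-common {z} az tz with z ≟ x
        ... | yes refl = x-neighbours t≢y t≢a (adj-flip G tz)
        ... | no z≢x = a-neighbours (≢-sym (Edge⇒≢ G tz)) z≢x t≢x az at

      a-leaf-⊥ : ¬ OtherNeighbour G a x → ⊥
      a-leaf-⊥ a-leaf =
        connected-closed-small G connG (x ∷ y ∷ a ∷ []) 3<n (closed-unless-escape G escape) (here refl)
        where
        escape : ∀ {s r} → s ∈ x ∷ y ∷ a ∷ [] → Edge G s r → r ∉ x ∷ y ∷ a ∷ [] → ⊥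
        escape (here refl) xr r∉ = x-neighbours (r∉ ∘ there ∘ here) (r∉ ∘ there ∘ there ∘ here) xr
        escape (there (here refl)) yr r∉ = Edge-NonEdge-⊥ G yr (no-other-neighbour G y-leaf (r∉ ∘ here))
        escape (there (there (here refl))) ar r∉ =
          Edge-NonEdge-⊥ G ar (no-other-neighbour G a-leaf (r∉ ∘ here))

      t-leaf-⊥ : ∀ {t} → t ≢ x → Edge G a t → ¬ OtherNeighbour G t a → ⊥
      t-leaf-⊥ {t} t≢x at t-leaf =
        connected-closed-small G connG (x ∷ y ∷ a ∷ t ∷ []) 5≤n (closed-unless-escape G escape) (here refl)
        where
        escape : ∀ {s r} → s ∈ x ∷ y ∷ a ∷ t ∷ [] → Edge G s r → r ∉ x ∷ y ∷ a ∷ t ∷ [] → ⊥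
        escape (here refl) xr r∉ = x-neighbours (r∉ ∘ there ∘ here) (r∉ ∘ there ∘ there ∘ here) xr
        escape (there (here refl)) yr r∉ = Edge-NonEdge-⊥ G yr (no-other-neighbour G y-leaf (r∉ ∘ here))
        escape (there (there (here refl))) ar r∉ =
          a-neighbours (r∉ ∘ there ∘ there ∘ there ∘ here) (r∉ ∘ here) t≢x ar at
        escape (there (there (there (here refl)))) tr r∉ =
          Edge-NonEdge-⊥ G tr (no-other-neighbour G t-leaf (r∉ ∘ there ∘ there ∘ here))

      lost-pendant : ⊥
      lost-pendant with other-neighbour? G a x
      ... | no a-leaf = a-leaf-⊥ a-leaf
      ... | yes (t , t≢x , at) with other-neighbour? G t a
      ...   | yes (b , b≢a , tb) = lost-both-extended (lost-next t≢x at) (≢-sym t≢x) (adj-flip G xa) b≢a tb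
      ...   | no t-leaf = t-leaf-⊥ t≢x at t-leaf

    lost-impossible : ∀ {x y} → Lost x y → ⊥
    lost-impossible {x} {y} L with other-neighbour? G x y | other-neighbour? G y x
    ... | yes (a , a≢y , xa) | yes (b , b≢x , yb) = lost-both-extended L a≢y xa b≢x yb
    ... | yes (a , a≢y , xa) | no y-leaf = Pendant.lost-pendant L a≢y xa y-leaf
    ... | no x-leaf | yes (b , b≢x , yb) = Pendant.lost-pendant (lost-flip L) b≢x yb x-leaf
    ... | no x-leaf | no y-leaf =
      connected-closed-small G connG (x ∷ y ∷ []) 2<n (closed-unless-escape G escape) (here refl)
      where
      escape : ∀ {s r} → s ∈ x ∷ y ∷ [] → Edge G s r → r ∉ x ∷ y ∷ [] → ⊥
      escape (here refl) xr r∉ = Edge-NonEdge-⊥ G xr (no-other-neighbour G x-leaf (r∉ ∘ there ∘ here))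
      escape (there (here refl)) yr r∉ = Edge-NonEdge-⊥ G yr (no-other-neighbour G y-leaf (r∉ ∘ here))

    triangle-free-edge-kept : ∀ {x y} → Edge G x y → NoCommonNeighbour G x y → Edge H x y
    triangle-free-edge-kept {x} {y} xy no-common with adj H x y in xy∉H
    ... | true  = refl
    ... | false = ⊥-elim (lost-impossible record { in-G = xy ; not-in-H = xy∉H ; no-common = no-common })

same-edges⇒Identical : ∀ {n} (H G : Graph n) → (∀ {x y} → Edge G x y → Edge H x y) →
                       (∀ {x y} → Edge H x y → Edge G x y) → Identical H G
same-edges⇒Identical H G G⊆H H⊆G x y with adj G x y in g | adj H x y in h
... | true  | _     = trans (≡.sym h) (G⊆H g)
... | false | false = refl
... | false | true  with () ← trans (≡.sym (H⊆G h)) g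

module _ {n : ℕ} {H G : Graph n} (same : SameT₃ H G) where

  open SameT₃ same

  gained-edge-twins : (∀ {a b} → Edge G a b → Edge H a b) → ∀ {x y} → Edge H x y → NonEdge G x y →
                      ∀ {w} → w ≢ y → Edge G x w → Edge G y w
  gained-edge-twins G⊆H {x} {y} Hxy Gxy {w} w≢y xw = ∧-conicalʳ _ _ joined
    where
    joined : adj G x w ∧ adj G y w ≡ true
    joined = trans (≡.sym (t₃-by G Gxy refl refl))
               (trans (≡.sym (t₃-≡ x y w (Edge⇒≢ H Hxy) (Edge⇒≢ G xw) (≢-sym w≢y)))
                 (t₃-by H Hxy (G⊆H xw) refl))

conditions⇒reconstructible : ∀ {n} → 5 ≤ n → (G : Graph n) → Connected G → CondA G → CondB G →
                             StronglyT3Reconstructible G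
conditions⇒reconstructible 5≤n G connG condA condB H connH sameT3 = same-edges⇒Identical H G G⊆H H⊆G
  where
  same = SameT3⇒SameT₃ H G sameT3
  G⊆H : ∀ {x y} → Edge G x y → Edge H x y
  G⊆H {x} {y} xy with any? (λ z → (adj G x z ≟ᵇ true) ×-dec (adj G y z ≟ᵇ true))
  ... | no none = triangle-free-edge-kept same 5≤n connG connH xy (λ xz yz → none (_ , xz , yz))
  ... | yes (z , xz , yz) with condB x y (xy , z , xz , yz)
  ...   | inj₁ realized = realizes⇒Edge same realized
  ...   | inj₂ realized = adj-flip H (realizes⇒Edge same realized)
  H⊆G : ∀ {x y} → Edge H x y → Edge G x y
  H⊆G {x} {y} Hxy with adj G x y in Gxy
  ... | true  = refl
  ... | false = ⊥-elim (condA x y (Edge⇒≢ H Hxy) λ w → mk⇔ (x→y w) (y→x w))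
    where
    x→y : ∀ w → NbhMinus G x y w → NbhMinus G y x w
    x→y w (xw , w≢y) = gained-edge-twins same G⊆H Hxy Gxy w≢y xw , ≢-sym (Edge⇒≢ G xw)
    y→x : ∀ w → NbhMinus G y x w → NbhMinus G x y w
    y→x w (yw , w≢x) =
      gained-edge-twins same G⊆H (adj-flip H Hxy) (adj-flip G Gxy) w≢x yw , ≢-sym (Edge⇒≢ G yw)

Twins : ∀ {n} → Graph n → Fin n → Fin n → Set
Twins G p q = ∀ {z} → z ≢ p → z ≢ q → adj G p z ≡ adj G q z

module Toggle {n : ℕ} (G : Graph n) {p q : Fin n} (p≢q : p ≢ q) where

  is-pq : Fin n → Fin n → Bool
  is-pq x y = does (x ≟ p) ∧ does (y ≟ q) ∨ does (x ≟ q) ∧ does (y ≟ p)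

  is-pq-sym : ∀ x y → is-pq x y ≡ is-pq y x
  is-pq-sym x y =
    trans (cong₂ _∨_ (∧-comm (does (x ≟ p)) _) (∧-comm (does (x ≟ q)) _)) (∨-comm (does (y ≟ q) ∧ _) _)

  is-pq-irrefl : ∀ x → is-pq x x ≡ false
  is-pq-irrefl x with x ≟ p | x ≟ q
  ... | yes x≡p | yes x≡q = ⊥-elim (p≢q (trans (≡.sym x≡p) x≡q))
  ... | yes _   | no _    = refl
  ... | no _    | yes _   = refl
  ... | no _    | no _    = refl

  toggle : Graph n
  toggle = record
    { adj    = λ x y → is-pq x y xor adj G x y
    ; sym    = λ x y → cong₂ _xor_ (is-pq-sym x y) (sym G x y)
    ; irrefl = λ x → trans (cong (_xor adj G x x) (is-pq-irrefl x)) (irrefl G x)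
    }

  toggle-pq : adj toggle p q ≡ not (adj G p q)
  toggle-pq rewrite dec-true (p ≟ p) refl | dec-true (q ≟ q) refl = refl

  toggle-differs : ¬ Identical toggle G
  toggle-differs same = not-¬ refl (trans (≡.sym (same p q)) toggle-pq)

  toggle-outside : ∀ {x y} → x ≢ p → x ≢ q → adj toggle x y ≡ adj G x y
  toggle-outside {x} x≢p x≢q rewrite dec-false (x ≟ p) x≢p | dec-false (x ≟ q) x≢q = refl

  toggle-outside₂ : ∀ {x y} → y ≢ p → y ≢ q → adj toggle x y ≡ adj G x y
  toggle-outside₂ {x} {y} y≢p y≢q = trans (sym toggle x y) (trans (toggle-outside y≢p y≢q) (sym G y x))

  In : Fin n → Set
  In = InPair p q

  toggle-changed-in : ∀ {x y} → adj toggle x y ≢ adj G x y → In x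
  toggle-changed-in {x} changed with in-pair? p q x
  ... | inj₁ x-in          = x-in
  ... | inj₂ (x≢p , x≢q) = ⊥-elim (changed (toggle-outside x≢p x≢q))

  module _ (twins : Twins G p q) where

    twins-at : ∀ {a b c} → In a → In b → a ≢ b → c ≢ p → c ≢ q → adj G a c ≡ adj G b c
    twins-at (inj₁ refl) (inj₁ refl) a≢b _ _ = ⊥-elim (a≢b refl)
    twins-at (inj₁ refl) (inj₂ refl) _ c≢p c≢q = twins c≢p c≢q
    twins-at (inj₂ refl) (inj₁ refl) _ c≢p c≢q = ≡.sym (twins c≢p c≢q)
    twins-at (inj₂ refl) (inj₂ refl) a≢b _ _ = ⊥-elim (a≢b refl)

    toggle-same-t₃ : SameT₃ toggle G
    toggle-same-t₃ = same-t₃ same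
      where
      same : ∀ a b c → a ≢ b → a ≢ c → b ≢ c → t₃ toggle a b c ≡ t₃ G a b c
      same a b c a≢b a≢c b≢c with in-pair? p q a | in-pair? p q b | in-pair? p q c
      ... | inj₂ (a≢p , a≢q) | inj₂ (b≢p , b≢q) | _ =
        t₃-agree toggle G (toggle-outside a≢p a≢q) (toggle-outside a≢p a≢q) (toggle-outside b≢p b≢q)
      ... | inj₂ (a≢p , a≢q) | _ | inj₂ (c≢p , c≢q) =
        t₃-agree toggle G (toggle-outside a≢p a≢q) (toggle-outside a≢p a≢q) (toggle-outside₂ c≢p c≢q)
      ... | _ | inj₂ (b≢p , b≢q) | inj₂ (c≢p , c≢q) =
        t₃-agree toggle G (toggle-outside₂ b≢p b≢q) (toggle-outside₂ c≢p c≢q) (toggle-outside₂ c≢p c≢q)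
      ... | inj₁ a-in | inj₁ b-in | inj₂ (c≢p , c≢q) =
        t₃-agree-but₁₂ toggle G (toggle-outside₂ c≢p c≢q) (toggle-outside₂ c≢p c≢q)
                                (twins-at a-in b-in a≢b c≢p c≢q)
      ... | inj₁ a-in | inj₂ (b≢p , b≢q) | inj₁ c-in =
        t₃-agree-but₁₃ toggle G (toggle-outside₂ b≢p b≢q) (toggle-outside₂ b≢p b≢q)
                                (twins-at a-in c-in a≢c b≢p b≢q)
      ... | inj₂ (a≢p , a≢q) | inj₁ b-in | inj₁ c-in =
        t₃-agree-but₂₃ toggle G (toggle-outside₂ a≢p a≢q) (toggle-outside₂ a≢p a≢q)
                                (twins-at b-in c-in b≢c a≢p a≢q)
      ... | inj₁ a-in | inj₁ b-in | inj₁ c-in = ⊥-elim (no-three-in-pair a-in b-in c-in a≢b a≢c b≢c)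

    module _ (5≤n : 5 ≤ n) (connG : Connected G) where

      common-neighbour : ∃ λ w → w ≢ p × w ≢ q × Edge G p w
      common-neighbour with any? (λ w → ¬? (w ≟ p) ×-dec ¬? (w ≟ q) ×-dec edge? G p w)
      ... | yes found = found
      ... | no none =
        ⊥-elim (connected-closed-small G connG (p ∷ q ∷ []) (<⇒≤ (<⇒≤ 5≤n))
                                       (closed-unless-escape G escape) (here refl))
        where
        escape : ∀ {s r} → s ∈ p ∷ q ∷ [] → Edge G s r → r ∉ p ∷ q ∷ [] → ⊥
        escape (here refl) pr r∉ = none (_ , r∉ ∘ here , r∉ ∘ there ∘ here , pr)
        escape (there (here refl)) qr r∉ =
          none (_ , r∉ ∘ here , r∉ ∘ there ∘ here , trans (twins (r∉ ∘ here) (r∉ ∘ there ∘ here)) qr)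

      w = proj₁ common-neighbour
      w≢p = proj₁ (proj₂ common-neighbour)
      w≢q = proj₁ (proj₂ (proj₂ common-neighbour))

      hub : ∀ {x} → In x → Edge toggle x w
      hub (inj₁ refl) = trans (toggle-outside₂ w≢p w≢q) (proj₂ (proj₂ (proj₂ common-neighbour)))
      hub (inj₂ refl) = trans (toggle-outside₂ w≢p w≢q)
                          (trans (≡.sym (twins w≢p w≢q)) (proj₂ (proj₂ (proj₂ common-neighbour))))

      -- The only edge toggle may delete is pq, which is bypassed through the common neighbour w.
      edge-walk : ∀ {x y} → Edge G x y → WalkIn toggle (λ _ → ⊤) x y
      edge-walk {x} {y} xy with adj toggle x y in xy′
      ... | true  = step tt xy′ (here tt)
      ... | false = step tt (hub (toggle-changed-in changed))
                      (step tt (adj-flip toggle {y} (hub (toggle-changed-in (changed ∘ flip)))) (here tt))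
        where
        changed : adj toggle x y ≢ adj G x y
        changed e with () ← trans (≡.sym xy′) (trans e xy)
        flip : adj toggle y x ≡ adj G y x → adj toggle x y ≡ adj G x y
        flip e = trans (sym toggle x y) (trans e (sym G y x))

      walk-toggle : ∀ {S x y} → WalkIn G S x y → WalkIn toggle (λ _ → ⊤) x y
      walk-toggle (here _)      = here tt
      walk-toggle (step _ xy w) = walk-app toggle (edge-walk xy) (walk-toggle w)

      toggle-connected : Connected toggle
      toggle-connected x y _ _ = walk-toggle (connG x y tt tt)

neighbourhoods⇒twins : ∀ {n} (G : Graph n) {p q} → (∀ w → NbhMinus G p q w ⇔ NbhMinus G q p w) → Twins G p q
neighbourhoods⇒twins G {p} {q} same {z} z≢p z≢q with adj G p z in pz | adj G q z in qz
... | true  | true  = refl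
... | false | false = refl
... | true  | false with () ← trans (≡.sym (proj₁ (Equivalence.to (same z) (pz , z≢q)))) qz
... | false | true  with () ← trans (≡.sym (proj₁ (Equivalence.from (same z) (qz , z≢p)))) pz

reconstructible⇒condA : ∀ {n} → 5 ≤ n → (G : Graph n) → Connected G → StronglyT3Reconstructible G → CondA G
reconstructible⇒condA 5≤n G connG reconstructible p q p≢q same-neighbourhoods =
  toggle-differs (reconstructible toggle (toggle-connected twins 5≤n connG)
                                          (SameT₃⇒SameT3 toggle G (toggle-same-t₃ twins)))
  where
  open Toggle G p≢q
  twins = neighbourhoods⇒twins G same-neighbourhoods

-- Path modules

relabel : ∀ {n} → Graph n → Permutation′ n → Graph n
relabel G π = record
  { adj    = λ x y → adj G (π ⟨$⟩ʳ x) (π ⟨$⟩ʳ y)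
  ; sym    = λ x y → sym G (π ⟨$⟩ʳ x) (π ⟨$⟩ʳ y)
  ; irrefl = λ x → irrefl G (π ⟨$⟩ʳ x)
  }

relabel-connected : ∀ {n} (G : Graph n) (π : Permutation′ n) → Connected G → Connected (relabel G π)
relabel-connected G π conn x y _ _ =
  ≡.subst₂ (WalkIn (relabel G π) _) (inverseˡ π) (inverseˡ π) (pull (conn (π ⟨$⟩ʳ x) (π ⟨$⟩ʳ y) tt tt))
  where
  pull : ∀ {S u v} → WalkIn G S u v → WalkIn (relabel G π) (λ _ → ⊤) (π ⟨$⟩ˡ u) (π ⟨$⟩ˡ v)
  pull (here _)     = here tt
  pull (step _ e w) = step tt (trans (cong₂ (adj G) (inverseʳ π) (inverseʳ π)) e) (pull w)

record PathModule {n : ℕ} (G : Graph n) : Set where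
  field
    a b c d : Fin n
    ab : Edge G a b
    bc : Edge G b c
    cd : Edge G c d
    ac : NonEdge G a c
    ad : NonEdge G a d
    bd : NonEdge G b d
    outside : ∀ {z} → z ≢ a → z ≢ b → z ≢ c → z ≢ d →
              adj G a z ≡ adj G b z × adj G c z ≡ adj G b z × adj G d z ≡ adj G b z

module SwapMiddle {n : ℕ} (G : Graph n) (P : PathModule G) where
  open PathModule P

  a≢b : a ≢ b
  a≢b = Edge⇒≢ G ab
  b≢c : b ≢ c
  b≢c = Edge⇒≢ G bc
  a≢c : a ≢ c
  a≢c = ≢-sym (Edge-NonEdge⇒≢ G (adj-flip G cd) (adj-flip G ad))

  σ : Permutation′ n
  σ = transpose b c

  σb : σ ⟨$⟩ʳ b ≡ c
  σb rewrite dec-true (b ≟ b) refl = refl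

  σc : σ ⟨$⟩ʳ c ≡ b
  σc rewrite dec-false (c ≟ b) (≢-sym b≢c) | dec-true (c ≟ c) refl = refl

  σ-fixes : ∀ {x} → x ≢ b → x ≢ c → σ ⟨$⟩ʳ x ≡ x
  σ-fixes {x} x≢b x≢c rewrite dec-false (x ≟ b) x≢b | dec-false (x ≟ c) x≢c = refl

  swapped : Graph n
  swapped = relabel G σ

  swapped-differs : ¬ Identical swapped G
  swapped-differs same with () ← trans (≡.sym (trans (same a b) ab))
                                   (trans (cong₂ (adj G) (σ-fixes a≢b a≢c) σb) ac)

  Outside : Fin n → Set
  Outside z = z ≢ a × z ≢ b × z ≢ c × z ≢ d

  uniform : ∀ {z x} → Outside z → x ≡ a ⊎ x ≡ b ⊎ x ≡ c ⊎ x ≡ d → adj G x z ≡ adj G b z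
  uniform (z≢a , z≢b , z≢c , z≢d) (inj₁ refl)               = proj₁ (outside z≢a z≢b z≢c z≢d)
  uniform _                       (inj₂ (inj₁ refl))        = refl
  uniform (z≢a , z≢b , z≢c , z≢d) (inj₂ (inj₂ (inj₁ refl))) = proj₁ (proj₂ (outside z≢a z≢b z≢c z≢d))
  uniform (z≢a , z≢b , z≢c , z≢d) (inj₂ (inj₂ (inj₂ refl))) = proj₂ (proj₂ (outside z≢a z≢b z≢c z≢d))

  place : ∀ {y} → y ≢ b → y ≢ c → InPair a d y ⊎ Outside y
  place {y} y≢b y≢c with in-pair? a d y
  ... | inj₁ y-end           = inj₁ y-end
  ... | inj₂ (y≢a , y≢d) = inj₂ (y≢a , y≢b , y≢c , y≢d)

  end-in-path : ∀ {y} → InPair a d y → y ≡ a ⊎ y ≡ b ⊎ y ≡ c ⊎ y ≡ d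
  end-in-path (inj₁ y≡a) = inj₁ y≡a
  end-in-path (inj₂ y≡d) = inj₂ (inj₂ (inj₂ y≡d))

  c≈b-end : ∀ {y z} → InPair a d y → Outside z → t₃ G c y z ≡ t₃ G b y z
  c≈b-end {y} {z} y-end z-out = trans (t₃-tail G (like-y (inj₂ (inj₂ (inj₁ refl)))))
                                      (≡.sym (t₃-tail G (like-y (inj₂ (inj₁ refl)))))
    where
    like-y : ∀ {x} → x ≡ a ⊎ x ≡ b ⊎ x ≡ c ⊎ x ≡ d → adj G x z ≡ adj G y z
    like-y x-in = trans (uniform z-out x-in) (≡.sym (uniform z-out (end-in-path y-end)))

  -- b and c differ only towards a and d, where the edges ab, cd and ac, bd give equal majorities.
  c≈b : ∀ {y z} → y ≢ z → y ≢ b → y ≢ c → z ≢ b → z ≢ c → t₃ G c y z ≡ t₃ G b y z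
  c≈b {y} {z} y≢z y≢b y≢c z≢b z≢c with place y≢b y≢c | place z≢b z≢c
  ... | inj₁ (inj₁ refl) | inj₁ (inj₁ refl) = ⊥-elim (y≢z refl)
  ... | inj₁ (inj₂ refl) | inj₁ (inj₂ refl) = ⊥-elim (y≢z refl)
  ... | inj₁ (inj₁ refl) | inj₁ (inj₂ refl) =
    trans (t₃-by G (adj-flip G ac) cd ad) (≡.sym (t₃-by G (adj-flip G ab) bd ad))
  ... | inj₁ (inj₂ refl) | inj₁ (inj₁ refl) =
    trans (t₃-by G cd (adj-flip G ac) (adj-flip G ad)) (≡.sym (t₃-by G bd (adj-flip G ab) (adj-flip G ad)))
  ... | inj₁ y-end | inj₂ z-out = c≈b-end y-end z-out
  ... | inj₂ y-out | inj₁ z-end =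
    trans (t₃-swap₂₃ G c y z) (trans (c≈b-end z-end y-out) (≡.sym (t₃-swap₂₃ G b y z)))
  ... | inj₂ y-out | inj₂ z-out = t₃-by G (uniform y-out c-in) (uniform z-out c-in) refl
    where
    c-in : c ≡ a ⊎ c ≡ b ⊎ c ≡ c ⊎ c ≡ d
    c-in = inj₂ (inj₂ (inj₁ refl))

  Moved = InPair b c

  σ-one : ∀ {x y z} → Moved x → y ≢ z → y ≢ b → y ≢ c → z ≢ b → z ≢ c → t₃ G (σ ⟨$⟩ʳ x) y z ≡ t₃ G x y z
  σ-one (inj₁ refl) y≢z y≢b y≢c z≢b z≢c = trans (t₃-cong G σb refl refl) (c≈b y≢z y≢b y≢c z≢b z≢c)
  σ-one (inj₂ refl) y≢z y≢b y≢c z≢b z≢c = trans (t₃-cong G σc refl refl) (≡.sym (c≈b y≢z y≢b y≢c z≢b z≢c))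

  σ-two : ∀ {x y z} → Moved x → Moved y → x ≢ y → t₃ G (σ ⟨$⟩ʳ x) (σ ⟨$⟩ʳ y) z ≡ t₃ G x y z
  σ-two (inj₁ refl) (inj₁ refl) x≢y = ⊥-elim (x≢y refl)
  σ-two (inj₁ refl) (inj₂ refl) _   = trans (t₃-cong G σb σc refl) (t₃-swap₁₂ G c b _)
  σ-two (inj₂ refl) (inj₁ refl) _   = trans (t₃-cong G σc σb refl) (t₃-swap₁₂ G b c _)
  σ-two (inj₂ refl) (inj₂ refl) x≢y = ⊥-elim (x≢y refl)

  swapped-same-t₃ : SameT₃ swapped G
  swapped-same-t₃ = same-t₃ same
    where
    open ≡.≡-Reasoning
    same : ∀ x y z → x ≢ y → x ≢ z → y ≢ z → t₃ swapped x y z ≡ t₃ G x y z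
    same x y z x≢y x≢z y≢z with in-pair? b c x | in-pair? b c y | in-pair? b c z
    ... | inj₂ (x≢b , x≢c) | inj₂ (y≢b , y≢c) | inj₂ (z≢b , z≢c) =
      t₃-cong G (σ-fixes x≢b x≢c) (σ-fixes y≢b y≢c) (σ-fixes z≢b z≢c)
    ... | inj₁ x-in | inj₂ (y≢b , y≢c) | inj₂ (z≢b , z≢c) =
      trans (t₃-cong G refl (σ-fixes y≢b y≢c) (σ-fixes z≢b z≢c)) (σ-one x-in y≢z y≢b y≢c z≢b z≢c)
    ... | inj₂ (x≢b , x≢c) | inj₁ y-in | inj₂ (z≢b , z≢c) = begin
      t₃ G (σ ⟨$⟩ʳ x) (σ ⟨$⟩ʳ y) (σ ⟨$⟩ʳ z) ≡⟨ t₃-cong G (σ-fixes x≢b x≢c) refl (σ-fixes z≢b z≢c) ⟩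
      t₃ G x (σ ⟨$⟩ʳ y) z                    ≡⟨ t₃-swap₁₂ G x _ z ⟩
      t₃ G (σ ⟨$⟩ʳ y) x z                    ≡⟨ σ-one y-in x≢z x≢b x≢c z≢b z≢c ⟩
      t₃ G y x z                             ≡⟨ t₃-swap₁₂ G y x z ⟩
      t₃ G x y z                             ∎
    ... | inj₂ (x≢b , x≢c) | inj₂ (y≢b , y≢c) | inj₁ z-in = begin
      t₃ G (σ ⟨$⟩ʳ x) (σ ⟨$⟩ʳ y) (σ ⟨$⟩ʳ z) ≡⟨ t₃-cong G (σ-fixes x≢b x≢c) (σ-fixes y≢b y≢c) refl ⟩
      t₃ G x y (σ ⟨$⟩ʳ z)                    ≡⟨ t₃-rotate G x y _ ⟩
      t₃ G (σ ⟨$⟩ʳ z) x y                    ≡⟨ σ-one z-in x≢y x≢b x≢c y≢b y≢c ⟩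
      t₃ G z x y                             ≡⟨ t₃-rotate G x y z ⟨
      t₃ G x y z                             ∎
    ... | inj₁ x-in | inj₁ y-in | inj₂ (z≢b , z≢c) =
      trans (t₃-cong G refl refl (σ-fixes z≢b z≢c)) (σ-two x-in y-in x≢y)
    ... | inj₁ x-in | inj₂ (y≢b , y≢c) | inj₁ z-in = begin
      t₃ G (σ ⟨$⟩ʳ x) (σ ⟨$⟩ʳ y) (σ ⟨$⟩ʳ z) ≡⟨ t₃-cong G refl (σ-fixes y≢b y≢c) refl ⟩
      t₃ G (σ ⟨$⟩ʳ x) y (σ ⟨$⟩ʳ z)          ≡⟨ t₃-swap₂₃ G _ y _ ⟩
      t₃ G (σ ⟨$⟩ʳ x) (σ ⟨$⟩ʳ z) y          ≡⟨ σ-two x-in z-in x≢z ⟩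
      t₃ G x z y                             ≡⟨ t₃-swap₂₃ G x y z ⟨
      t₃ G x y z                             ∎
    ... | inj₂ (x≢b , x≢c) | inj₁ y-in | inj₁ z-in = begin
      t₃ G (σ ⟨$⟩ʳ x) (σ ⟨$⟩ʳ y) (σ ⟨$⟩ʳ z) ≡⟨ t₃-cong G (σ-fixes x≢b x≢c) refl refl ⟩
      t₃ G x (σ ⟨$⟩ʳ y) (σ ⟨$⟩ʳ z)          ≡⟨ t₃-rotate G _ _ x ⟨
      t₃ G (σ ⟨$⟩ʳ y) (σ ⟨$⟩ʳ z) x          ≡⟨ σ-two y-in z-in y≢z ⟩
      t₃ G y z x                             ≡⟨ t₃-rotate G y z x ⟩
      t₃ G x y z                             ∎
    ... | inj₁ x-in | inj₁ y-in | inj₁ z-in = ⊥-elim (no-three-in-pair x-in y-in z-in x≢y x≢z y≢z)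

path-module-not-reconstructible : ∀ {n} (G : Graph n) → Connected G → PathModule G →
                                  ¬ StronglyT3Reconstructible G
path-module-not-reconstructible G connG P reconstructible =
  swapped-differs (reconstructible swapped (relabel-connected G σ connG)
                                            (SameT₃⇒SameT3 swapped G swapped-same-t₃))
  where open SwapMiddle G P

-- Edges realizing no configuration

module _ {n : ℕ} (G : Graph n) where

  ≢? : ∀ (x y : Fin n) → Dec (x ≢ y)
  ≢? x y = ¬? (x ≟ y)

  distinct4? : ∀ a b c d → Dec (Distinct4 G a b c d)
  distinct4? a b c d = ≢? a b ×-dec ≢? a c ×-dec ≢? a d ×-dec ≢? b c ×-dec ≢? b d ×-dec ≢? c d

  distinct5? : ∀ a b c d e → Dec (Distinct5 G a b c d e)
  distinct5? a b c d e = distinct4? a b c d ×-dec ≢? a e ×-dec ≢? b e ×-dec ≢? c e ×-dec ≢? d e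

  F₁? : ∀ u v v₁ v₂ → Dec (F₁ G u v v₁ v₂)
  F₁? u v v₁ v₂ = edge? G u v ×-dec edge? G u v₁ ×-dec edge? G v v₂ ×-dec
                  non-edge? G v v₁ ×-dec non-edge? G v₁ v₂

  F₂? : ∀ u v v₁ v₂ → Dec (F₂ G u v v₁ v₂)
  F₂? u v v₁ v₂ = edge? G u v ×-dec edge? G v v₁ ×-dec edge? G v v₂ ×-dec
                  non-edge? G u v₁ ×-dec non-edge? G u v₂

  F₃? : ∀ u v v₁ v₂ v₃ → Dec (F₃ G u v v₁ v₂ v₃)
  F₃? u v v₁ v₂ v₃ = edge? G u v ×-dec edge? G u v₂ ×-dec edge? G v v₃ ×-dec edge? G v₂ v₃ ×-dec
                     edge? G v₁ v₂ ×-dec non-edge? G v v₂ ×-dec non-edge? G u v₁ ×-dec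
                     non-edge? G v v₁ ×-dec non-edge? G v₁ v₃

  F₄? : ∀ u v v₁ v₂ v₃ → Dec (F₄ G u v v₁ v₂ v₃)
  F₄? u v v₁ v₂ v₃ = edge? G u v ×-dec edge? G v v₁ ×-dec edge? G v₁ v₂ ×-dec edge? G v₁ v₃ ×-dec
                     non-edge? G u v₁ ×-dec non-edge? G u v₂ ×-dec non-edge? G u v₃ ×-dec
                     non-edge? G v v₂ ×-dec non-edge? G v v₃

  F₅? : ∀ u v v₁ v₂ v₃ → Dec (F₅ G u v v₁ v₂ v₃)
  F₅? u v v₁ v₂ v₃ = edge? G u v ×-dec edge? G u v₃ ×-dec edge? G v₃ v₂ ×-dec edge? G v₂ v₁ ×-dec
                     non-edge? G u v₁ ×-dec non-edge? G u v₂ ×-dec non-edge? G v v₁ ×-dec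
                     non-edge? G v v₂ ×-dec non-edge? G v v₃ ×-dec non-edge? G v₁ v₃

  F₆? : ∀ u v v₁ v₂ v₃ → Dec (F₆ G u v v₁ v₂ v₃)
  F₆? u v v₁ v₂ v₃ = edge? G u v ×-dec edge? G u v₁ ×-dec edge? G v v₃ ×-dec edge? G v₁ v₂ ×-dec
                     edge? G v₂ v₃ ×-dec non-edge? G v v₁ ×-dec non-edge? G u v₃ ×-dec
                     non-edge? G u v₂ ×-dec non-edge? G v v₂

  realizes? : ∀ u v → Dec (Realizes G u v)
  realizes? u v =
    any? (λ v₁ → any? λ v₂ → distinct4? u v v₁ v₂ ×-dec (F₁? u v v₁ v₂ ⊎-dec F₂? u v v₁ v₂))
    ⊎-dec
    any? (λ v₁ → any? λ v₂ → any? λ v₃ → distinct5? u v v₁ v₂ v₃ ×-dec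
            (F₃? u v v₁ v₂ v₃ ⊎-dec F₄? u v v₁ v₂ v₃ ⊎-dec F₅? u v v₁ v₂ v₃ ⊎-dec F₆? u v v₁ v₂ v₃))

  Private : Fin n → Fin n → Fin n → Set
  Private x y p = p ≢ y × Edge G x p × NonEdge G y p

  private? : ∀ x y → Dec (∃ (Private x y))
  private? x y = any? λ p → ≢? p y ×-dec edge? G x p ×-dec non-edge? G y p

  private-unique : ∀ {x y p₁ p₂} → Edge G x y → ¬ Realizes G y x →
                   Private x y p₁ → Private x y p₂ → p₁ ≢ p₂ → ⊥
  private-unique xy ¬yx (p₁≢y , xp₁ , yp₁) (p₂≢y , xp₂ , yp₂) p₁≢p₂ = ¬yx (inj₁ (_ , _ ,
    (≢-sym (Edge⇒≢ G xy) , ≢-sym p₁≢y , ≢-sym p₂≢y , Edge⇒≢ G xp₁ , Edge⇒≢ G xp₂ , p₁≢p₂) ,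
    inj₂ (adj-flip G xy , xp₁ , xp₂ , yp₁ , yp₂)))

  private-sees : ∀ {x y p z} → Edge G x y → ¬ Realizes G x y → Private x y p →
                 z ≢ x → Edge G y z → Edge G p z
  private-sees xy ¬xy (p≢y , xp , yp) z≢x yz = ¬-not λ pz → ¬xy (inj₁ (_ , _ ,
    (Edge⇒≢ G xy , Edge⇒≢ G xp , ≢-sym z≢x , ≢-sym p≢y , Edge⇒≢ G yz , ≢-sym (Edge-NonEdge⇒≢ G yz yp)) ,
    inj₁ (xy , xp , yz , yp , pz)))

  module _ (condA : CondA G) where

    not-twins : ∀ {x y} → x ≢ y → (∀ {w} → w ≢ y → Edge G x w → Edge G y w) →
                (∀ {w} → w ≢ x → Edge G y w → Edge G x w) → ⊥
    not-twins {x} {y} x≢y to from = condA x y x≢y λ w →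
      mk⇔ (λ (xw , w≢y) → to w≢y xw , ≢-sym (Edge⇒≢ G xw))
          (λ (yw , w≢x) → from w≢x yw , ≢-sym (Edge⇒≢ G yw))

    no-private-neighbours : ∀ {u v} → Edge G u v → ¬ ∃ (Private u v) → ¬ ∃ (Private v u) → ⊥
    no-private-neighbours uv noP noQ = not-twins (Edge⇒≢ G uv)
      (λ w≢v uw → ¬-not λ vw → noP (_ , w≢v , uw , vw))
      (λ w≢u vw → ¬-not λ uw → noQ (_ , w≢u , vw , uw))

    -- With private neighbours p of u and q of v, the vertices u and q would be twins.
    private-neighbours-both-sides : ∀ {u v p q} → Edge G u v → ¬ Realizes G u v → ¬ Realizes G v u →
                                    Private u v p → Private v u q → ⊥
    private-neighbours-both-sides {u} {v} {p} {q} uv ¬uv ¬vu P@(p≢v , up , vp) Q@(q≢u , vq , uq) =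
      not-twins (≢-sym q≢u) to from
      where
      vu = adj-flip G uv
      pq = private-sees uv ¬uv P q≢u vq
      to : ∀ {w} → w ≢ q → Edge G u w → Edge G q w
      to {w} w≢q uw with w ≟ v | adj G v w in vw
      ... | yes refl | _     = adj-flip G vq
      ... | no w≢v   | true  = private-sees vu ¬vu Q w≢v uw
      ... | no w≢v   | false with w ≟ p
      ...   | yes refl = adj-flip G pq
      ...   | no w≢p   = ⊥-elim (private-unique uv ¬vu (w≢v , uw , vw) P w≢p)
      from : ∀ {w} → w ≢ u → Edge G q w → Edge G u w
      from {w} w≢u qw = ¬-not λ uw → from-non-edge uw (≢-sym (Edge-NonEdge⇒≢ G uv uw))
        where
        from-non-edge : NonEdge G u w → w ≢ v → ⊥
        from-non-edge uw w≢v with adj G v w in vw | adj G w p in wp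
        ... | true  | _     = private-unique vu ¬uv (w≢u , vw , uw) Q (≢-sym (Edge⇒≢ G qw))
        ... | false | true  = ¬vu (inj₂ (q , w , p ,
              ((Edge⇒≢ G vu , Edge⇒≢ G vq , ≢-sym w≢v , ≢-sym q≢u , ≢-sym w≢u , Edge⇒≢ G qw) ,
                ≢-sym p≢v , Edge⇒≢ G up , ≢-sym (Edge⇒≢ G pq) , Edge⇒≢ G wp) ,
              inj₂ (inj₂ (inj₂ (vu , vq , up , qw , wp , uq , vp , vw , uw)))))
        ... | false | false = ¬vu (inj₂ (w , q , p ,
              ((Edge⇒≢ G vu , ≢-sym w≢v , Edge⇒≢ G vq , ≢-sym w≢u , ≢-sym q≢u , ≢-sym (Edge⇒≢ G qw)) ,
                ≢-sym p≢v , Edge⇒≢ G up , ≢-sym (Edge-NonEdge⇒≢ G up uw) , ≢-sym (Edge⇒≢ G pq)) ,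
              inj₁ (vu , vq , up , adj-flip G pq , adj-flip G qw , uq , vw , uw , wp)))

    module _ (connG : Connected G) (reconstructible : StronglyT3Reconstructible G) where

      -- With a private neighbour p of u and none of v: either v and p are twins, or p has a
      -- neighbour d away from u and v, and then v u p d is a path module.
      private-neighbour-one-side : ∀ {u v p} → Edge G u v → ¬ Realizes G u v → ¬ Realizes G v u →
                                   Private u v p → ¬ ∃ (Private v u) → ⊥
      private-neighbour-one-side {u} {v} {p} uv ¬uv ¬vu P@(p≢v , up , vp) noQ
        with any? (λ d → edge? G p d ×-dec non-edge? G u d ×-dec non-edge? G v d)
      ... | no no-d = not-twins (≢-sym p≢v) to from
        where
        to : ∀ {w} → w ≢ p → Edge G v w → Edge G p w
        to {w} w≢p vw with w ≟ u
        ... | yes refl = adj-flip G up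
        ... | no w≢u   = private-sees uv ¬uv P w≢u vw
        from : ∀ {w} → w ≢ v → Edge G p w → Edge G v w
        from {w} w≢v pw = ¬-not λ vw → from-non-edge vw
          where
          from-non-edge : NonEdge G v w → ⊥
          from-non-edge vw with w ≟ u | adj G u w in uw
          ... | yes refl | _     = Edge-NonEdge-⊥ G (adj-flip G uv) vw
          ... | no _     | true  = private-unique uv ¬vu (w≢v , uw , vw) P (≢-sym (Edge⇒≢ G pw))
          ... | no _     | false = no-d (w , pw , uw , vw)
      ... | yes (d , pd , ud , vd) = path-module-not-reconstructible G connG module-vupd reconstructible
        where
        u≢d = Edge-NonEdge⇒≢ G (adj-flip G uv) vd
        v≢d = Edge-NonEdge⇒≢ G uv ud
        outside : ∀ {z} → z ≢ v → z ≢ u → z ≢ p → z ≢ d →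
                  adj G v z ≡ adj G u z × adj G p z ≡ adj G u z × adj G d z ≡ adj G u z
        outside {z} z≢v z≢u z≢p z≢d with adj G u z in uz | adj G v z in vz
        ... | true  | true  = refl , pz , dz
          where
          pz = private-sees uv ¬uv P z≢u vz
          dz = ¬-not λ dz → ¬uv (inj₂ (d , p , z ,
                 ((Edge⇒≢ G uv , u≢d , Edge⇒≢ G up , v≢d , ≢-sym p≢v , ≢-sym (Edge⇒≢ G pd)) ,
                   ≢-sym z≢u , ≢-sym z≢v , ≢-sym z≢d , ≢-sym z≢p) ,
                 inj₁ (uv , up , vz , pz , adj-flip G pd , vp , ud , vd , dz)))
        ... | true  | false = ⊥-elim (private-unique uv ¬vu (z≢v , uz , vz) P z≢p)
        ... | false | true  = ⊥-elim (noQ (z , z≢u , vz , uz))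
        ... | false | false = refl , pz , dz
          where
          pz = ¬-not λ pz → ¬vu (inj₂ (p , d , z ,
                 ((Edge⇒≢ G (adj-flip G uv) , ≢-sym p≢v , v≢d , Edge⇒≢ G up , u≢d , Edge⇒≢ G pd) ,
                   ≢-sym z≢v , ≢-sym z≢u , ≢-sym z≢p , ≢-sym z≢d) ,
                 inj₂ (inj₁ (adj-flip G uv , up , pd , pz , vp , vd , vz , ud , uz))))
          dz = ¬-not λ dz → ¬uv (inj₂ (z , d , p ,
                 ((Edge⇒≢ G uv , ≢-sym z≢u , u≢d , ≢-sym z≢v , v≢d , z≢d) ,
                   Edge⇒≢ G up , ≢-sym p≢v , z≢p , ≢-sym (Edge⇒≢ G pd)) ,
                 inj₂ (inj₂ (inj₁ (uv , up , pd , dz , uz , ud , vz , vd , vp , adj-flip G pz)))))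
        module-vupd : PathModule G
        module-vupd = record
          { a = v ; b = u ; c = p ; d = d
          ; ab = adj-flip G uv ; bc = up ; cd = pd ; ac = vp ; ad = vd ; bd = ud
          ; outside = outside
          }

      edge-realized : ∀ {u v} → Edge G u v → Realizes G u v ⊎ Realizes G v u
      edge-realized {u} {v} uv with realizes? u v | realizes? v u
      ... | yes r   | _       = inj₁ r
      ... | no _    | yes r   = inj₂ r
      ... | no ¬uv  | no ¬vu  with private? u v | private? v u
      ...   | yes (_ , P) | yes (_ , Q) = ⊥-elim (private-neighbours-both-sides uv ¬uv ¬vu P Q)
      ...   | yes (_ , P) | no noQ      = ⊥-elim (private-neighbour-one-side uv ¬uv ¬vu P noQ)
      ...   | no noP      | yes (_ , Q) = ⊥-elim (private-neighbour-one-side (adj-flip G uv) ¬vu ¬uv Q noP)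
      ...   | no noP      | no noQ      = ⊥-elim (no-private-neighbours uv noP noQ)

-- Every edge realizes a configuration, whether or not it lies in a triangle.
reconstructible⇒condB : ∀ {n} → 5 ≤ n → (G : Graph n) → Connected G → StronglyT3Reconstructible G → CondB G
reconstructible⇒condB 5≤n G connG reconstructible x y (xy , _) =
  edge-realized G (reconstructible⇒condA 5≤n G connG reconstructible) connG reconstructible xy

theorem4p12 : (n : ℕ) → 5 ≤ n → (G : Graph n) → Connected G →
              (StronglyT3Reconstructible G ⇔ (CondA G × CondB G))
theorem4p12 n 5≤n G connG = mk⇔
  (λ reconstructible → reconstructible⇒condA 5≤n G connG reconstructible
                     , reconstructible⇒condB 5≤n G connG reconstructible)
  (λ (condA , condB) → conditions⇒reconstructible 5≤n G connG condA condB)
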